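{- Let $H$ be a $G_\phi$-graph with $m$ leaves, and let $A$ be a set of positive integers with $G_\phi(A)=H$. Then $|A|\ge m-1$.
   Context: $\phi$ denotes Euler's totient function, $\phi^0(n)=n$ and $\phi^i(n)=\phi(\phi^{i-1}(n))$. For a set $A$ of positive integers, $A_\phi=\{\phi^k(n): n\in A,\ k\ge 0\}$, and $G_\phi(A)$ is the simple graph with vertex set $A_\phi$ in which distinct vertices $r,s$ are adjacent iff $\phi(r)=s$ or $\phi(s)=r$. A graph $H$ is a $G_\phi$-graph if $H=G_\phi(A)$ for some set $A$ of positive integers. A leaf is a vertex of degree $1$. -}

module Defs where

open import Data.Nat using (ℕ; zero; suc; _<_; _∸_)
open import Data.Nat.GCD using (gcd)
open import Data.List using (List; length; filter; upTo)
open import Data.List.Membership.Propositional using (_∈_)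
open import Data.List.Relation.Unary.Unique.Propositional using (Unique)
open import Data.Fin using (Fin)
open import Data.Product using (Σ; ∃; ∃₂; _×_)
open import Data.Sum using (_⊎_)
open import Relation.Nullary using (¬_)
open import Relation.Binary.PropositionalEquality using (_≡_)
open import Function.Definitions using (Injective)
open import Function.Bundles using (_⇔_)
open import Data.Nat using (_≟_)

-- Euler's totient: φ n = #{ k : 1 ≤ k ≤ n , gcd k n = 1 }  (φ 0 = 0, φ 1 = 1)
φ : ℕ → ℕ
φ n = length (filter (λ k → gcd (suc k) n ≟ 1) (upTo n))

φ^ : ℕ → ℕ → ℕ
φ^ zero    n = n
φ^ (suc k) n = φ (φ^ k n)

PSet : Set₁
PSet = ℕ → Set

Positive : PSet → Set
Positive A = ∀ n → A n → 0 < n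

-- A_φ = { φ^k(n) : n ∈ A, k ≥ 0 }  (vertex set of G_φ(A))
Aφ : PSet → PSet
Aφ A v = ∃₂ λ n k → A n × φ^ k n ≡ v

Adj : ℕ → ℕ → Set
Adj r s = ¬ (r ≡ s) × (φ r ≡ s ⊎ φ s ≡ r)

IsLeaf : PSet → ℕ → Set
IsLeaf A v = Aφ A v × Σ ℕ (λ s → (Aφ A s × Adj v s) × (∀ t → Aφ A t → Adj v t → t ≡ s))

HasLeaves : PSet → ℕ → Set
HasLeaves A m = Σ (List ℕ) λ ls → Unique ls × length ls ≡ m × (∀ v → (IsLeaf A v ⇔ v ∈ ls))

CardGE : PSet → ℕ → Set
CardGE A k = Σ (Fin k → ℕ) λ f → Injective _≡_ _≡_ f × (∀ i → A (f i))

-- Every leaf v ≠ 1 of G_φ(A) lies in A. Otherwise v = φ u for some u ∈ A_φ,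
-- and when v ≥ 2 both u and φ v are neighbours of v; being a leaf forces u = φ v,
-- i.e. φ (φ v) = v, which is impossible because φ n < n for n ≥ 2. Hence all
-- leaves but possibly 1 are distinct elements of A.
module Submission where

open import Defs
open import Data.Nat using (ℕ; zero; suc; _∸_; _<_; _≤_; z≤n; s≤s; _≟_)
open import Data.Nat.Properties
  using (≤-refl; <-irrefl; ≤-<-trans; ≤∧≢⇒<; ∸-monoˡ-≤)
open import Data.Nat.Divisibility using (∣-antisym; ∣-refl)
open import Data.Nat.GCD using (gcd; gcd[m,n]∣m; gcd-greatest; gcd-zeroˡ)
open import Data.List using (List; []; _∷_; length; filter; upTo; lookup)
open import Data.List.Properties using (length-filter; length-upTo; filter-notAll; filter-some; filter-accept; filter-reject; filter-all)
open import Data.List.Membership.Propositional using (_∈_)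
open import Data.List.Membership.Propositional.Properties using (∈-upTo⁺; ∈-filter⁻; ∈-lookup)
open import Data.List.Relation.Unary.Any as Any using (here)
open import Data.List.Relation.Unary.All as All using (All)
open import Data.List.Relation.Unary.AllPairs using (_∷_)
open import Data.List.Relation.Unary.Unique.Propositional using (Unique)
open import Data.List.Relation.Unary.Unique.Propositional.Properties using (filter⁺)
open import Data.Fin using (inject≤) renaming (zero to fzero; suc to fsuc)
open import Data.Fin.Properties using (inject≤-injective)
open import Data.Product using (_,_)
open import Data.Sum using (inj₁; inj₂)
open import Data.Empty using (⊥-elim)
open import Relation.Nullary using (Dec; yes; no; ¬_; ¬?)
open import Relation.Binary.PropositionalEquality using (_≡_; _≢_; refl; sym; trans; cong; subst)
open import Function.Definitions using (Injective)
open import Function.Bundles using (Equivalence)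

gcd[n,n]≡n : ∀ n → gcd n n ≡ n
gcd[n,n]≡n n = ∣-antisym (gcd[m,n]∣m n n) (gcd-greatest ∣-refl ∣-refl)

coprimeTo? : ∀ n k → Dec (gcd (suc k) n ≡ 1)
coprimeTo? n k = gcd (suc k) n ≟ 1

φ[n]≤n : ∀ n → φ n ≤ n
φ[n]≤n n = subst (φ n ≤_) (length-upTo n) (length-filter (coprimeTo? n) (upTo n))

-- The last candidate k = n - 1 is rejected since gcd n n = n ≠ 1.
φ[n]<n : ∀ {n} → 1 < n → φ n < n
φ[n]<n {1} (s≤s ())
φ[n]<n {n@(suc (suc m))} _ =
  subst (φ n <_) (length-upTo n) (filter-notAll (coprimeTo? n) (upTo n) n-1-rejected)
  where
  n-1-rejected : Any.Any (λ k → ¬ (gcd (suc k) n ≡ 1)) (upTo n)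
  n-1-rejected = Any.map rejected (∈-upTo⁺ {n} {suc m} ≤-refl)
    where
    rejected : ∀ {k} → suc m ≡ k → ¬ (gcd (suc k) n ≡ 1)
    rejected refl gcd≡1 with trans (sym (gcd[n,n]≡n n)) gcd≡1
    ... | ()

φ[φ[n]]<n : ∀ {n} → 1 < n → φ (φ n) < n
φ[φ[n]]<n 1<n = ≤-<-trans (φ[n]≤n _) (φ[n]<n 1<n)

0<n⇒0<φ[n] : ∀ {n} → 0 < n → 0 < φ n
0<n⇒0<φ[n] {suc m} _ = filter-some (coprimeTo? (suc m)) {upTo (suc m)} (here (gcd-zeroˡ (suc m)))

0<n⇒0<φ^[n] : ∀ k {n} → 0 < n → 0 < φ^ k n
0<n⇒0<φ^[n] zero    0<n = 0<n
0<n⇒0<φ^[n] (suc k) 0<n = 0<n⇒0<φ[n] (0<n⇒0<φ^[n] k 0<n)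

Aφ-positive : ∀ {A} → Positive A → ∀ {v} → Aφ A v → 0 < v
Aφ-positive pos (n , k , n∈A , refl) = 0<n⇒0<φ^[n] k (pos n n∈A)

Aφ-φ-closed : ∀ {A v} → Aφ A v → Aφ A (φ v)
Aφ-φ-closed (n , k , n∈A , refl) = n , suc k , n∈A , refl

Adj[n,φ[n]] : ∀ {n} → 1 < n → Adj n (φ n)
Adj[n,φ[n]] 1<n = (λ n≡φn → <-irrefl (sym n≡φn) (φ[n]<n 1<n)) , inj₁ refl

φ[u]≡n⇒Adj[n,u] : ∀ {n u} → 1 < n → φ u ≡ n → Adj n u
φ[u]≡n⇒Adj[n,u] 1<n refl = (λ φu≡u → <-irrefl φu≡u (φ[n]<n (subst (1 <_) φu≡u 1<n))) , inj₂ refl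

IsLeaf⇒∈ : ∀ {A} → Positive A → ∀ {v} → IsLeaf A v → v ≢ 1 → A v
IsLeaf⇒∈ pos ((n , zero , n∈A , refl) , _) _ = n∈A
IsLeaf⇒∈ pos {v} (v∈Aφ@(n , suc k , n∈A , φu≡v) , s , _ , onlyNeighbour) v≢1 =
  ⊥-elim (<-irrefl φ[φ[v]]≡v (φ[φ[n]]<n 1<v))
  where
  u = φ^ k n
  1<v : 1 < v
  1<v = ≤∧≢⇒< (Aφ-positive pos v∈Aφ) (λ 1≡v → v≢1 (sym 1≡v))
  u≡s : u ≡ s
  u≡s = onlyNeighbour u (n , k , n∈A , refl) (φ[u]≡n⇒Adj[n,u] 1<v φu≡v)
  φ[v]≡s : φ v ≡ s
  φ[v]≡s = onlyNeighbour (φ v) (Aφ-φ-closed v∈Aφ) (Adj[n,φ[n]] 1<v)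
  φ[φ[v]]≡v : φ (φ v) ≡ v
  φ[φ[v]]≡v = trans (cong φ (trans φ[v]≡s (sym u≡s))) φu≡v

_≢?_ : ∀ x a → Dec (x ≢ a)
x ≢? a = ¬? (x ≟ a)

length≤1+length-filter-≢ : ∀ a {xs : List ℕ} → Unique xs →
  length xs ≤ suc (length (filter (_≢? a) xs))
length≤1+length-filter-≢ a {[]} _ = z≤n
length≤1+length-filter-≢ a {x ∷ xs} (x∉xs ∷ xs!) with x ≟ a
... | yes refl
  rewrite filter-reject (_≢? a) {x} {xs} (λ x≢x → x≢x refl)
        | filter-all (_≢? a) (All.map (λ x≢y y≡x → x≢y (sym y≡x)) x∉xs) = ≤-refl
... | no x≢a rewrite filter-accept (_≢? a) {x} {xs} x≢a =
  s≤s (length≤1+length-filter-≢ a xs!)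

lookup-injective : ∀ {X : Set} {xs : List X} → Unique xs → Injective _≡_ _≡_ (lookup xs)
lookup-injective {xs = _ ∷ _} _           {fzero}  {fzero}  _ = refl
lookup-injective {xs = _ ∷ _} (x∉xs ∷ _)  {fzero}  {fsuc j} e = ⊥-elim (All.lookup x∉xs (∈-lookup j) e)
lookup-injective {xs = _ ∷ _} (x∉xs ∷ _)  {fsuc i} {fzero}  e = ⊥-elim (All.lookup x∉xs (∈-lookup i) (sym e))
lookup-injective {xs = _ ∷ _} (_ ∷ xs!)   {fsuc i} {fsuc j} e = cong fsuc (lookup-injective xs! e)

Unique⇒CardGE-length : ∀ {A} {xs : List ℕ} → Unique xs → All A xs → CardGE A (length xs)
Unique⇒CardGE-length {xs = xs} xs! xs⊆A =
  lookup xs , lookup-injective xs! , λ i → All.lookup xs⊆A (∈-lookup i)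

CardGE-anti-mono : ∀ {A k l} → k ≤ l → CardGE A l → CardGE A k
CardGE-anti-mono k≤l (f , f-inj , f∈A) =
  (λ i → f (inject≤ i k≤l)) , (λ e → inject≤-injective k≤l k≤l _ _ (f-inj e)) , λ i → f∈A (inject≤ i k≤l)

theorem2p14 : (A : PSet) → Positive A → (m : ℕ) → HasLeaves A m → CardGE A (m ∸ 1)
theorem2p14 A pos m (leaves , leaves! , refl , isLeaf⇔∈) =
  CardGE-anti-mono {A} (∸-monoˡ-≤ 1 (length≤1+length-filter-≢ 1 leaves!))
    (Unique⇒CardGE-length (filter⁺ (_≢? 1) leaves!) (All.tabulate nonOne-leaf∈A))
  where
  nonOne-leaf∈A : ∀ {v} → v ∈ filter (_≢? 1) leaves → A v
  nonOne-leaf∈A {v} v∈ with ∈-filter⁻ (_≢? 1) {xs = leaves} v∈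
  ... | v∈leaves , v≢1 = IsLeaf⇒∈ pos (Equivalence.from (isLeaf⇔∈ v) v∈leaves) v≢1
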